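{- In any alternating floorplan $F$, every tile has either its bottom-right corner or its top-left corner on the alternating path of $F$.
   Context: For a positive integer $n$, an alternating floorplan of size $n$ is a partition of a rectangle $R$ of width $\lceil (n+1)/2\rceil$ and height $\lfloor (n+1)/2\rfloor$ into $n$ rectangular tiles whose sides have integer lengths, such that the lattice path from the south-west corner to the north-east corner of $R$ that moves alternately one unit step east and one unit step north, starting with east (called the alternating path of $F$), is contained in the union of the boundaries of the tiles. -}

module Defs where

open import Data.Nat using (ℕ; zero; suc; _≤_; _<_; ⌊_/2⌋; ⌈_/2⌉)
open import Data.Fin using (Fin)
open import Data.Product using (_×_; _,_; proj₁; proj₂; ∃)
open import Data.Sum using (_⊎_)
open import Relation.Binary.PropositionalEquality using (_≡_)

-- Lattice points (x , y) with x the horizontal and y the vertical coordinate.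
Point : Set
Point = ℕ × ℕ

record Tile : Set where
  field
    x₁ x₂ y₁ y₂ : ℕ
    x₁<x₂ : x₁ < x₂
    y₁<y₂ : y₁ < y₂
open Tile public

width height : ℕ → ℕ
width n = ⌈ suc n /2⌉
height n = ⌊ suc n /2⌋

-- Tile t contains the unit cell [a , a+1] × [b , b+1].
ContainsCell : Tile → ℕ → ℕ → Set
ContainsCell t a b = (x₁ t ≤ a × a < x₂ t) × (y₁ t ≤ b × b < y₂ t)

record Floorplan (n : ℕ) : Set where
  field
    tile : Fin n → Tile
    inside : ∀ i → x₂ (tile i) ≤ width n × y₂ (tile i) ≤ height n
    cover : ∀ a b → a < width n → b < height n → ∃ λ i → ContainsCell (tile i) a b
    disjoint : ∀ i j a b → ContainsCell (tile i) a b → ContainsCell (tile j) a b → i ≡ j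
open Floorplan public

-- For size n it has n+2 vertices
-- (indices 0 .. n+1) and ends at the north-east corner of R.
pathPt : ℕ → Point
pathPt i = ⌈ i /2⌉ , ⌊ i /2⌋

-- A point lies on the alternating path of size n (lattice points of the path
-- are exactly its vertices).
OnPath : ℕ → Point → Set
OnPath n p = ∃ λ i → i ≤ suc n × pathPt i ≡ p

SegOnBoundary : Tile → Point → Point → Set
SegOnBoundary t (px , py) (qx , qy) =
    (qy ≡ py × qx ≡ suc px × (py ≡ y₁ t ⊎ py ≡ y₂ t) × x₁ t ≤ px × qx ≤ x₂ t)
  ⊎ (qx ≡ px × qy ≡ suc py × (px ≡ x₁ t ⊎ px ≡ x₂ t) × y₁ t ≤ py × qy ≤ y₂ t)

-- Alternating floorplan: every unit step of the alternating path lies in the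
-- union of the tile boundaries (equivalently, on the boundary of some tile).
IsAlternating : ∀ {n} → Floorplan n → Set
IsAlternating {n} F =
  ∀ i → i ≤ n → ∃ λ j → SegOnBoundary (tile F j) (pathPt i) (pathPt (suc i))

record AlternatingFloorplan (n : ℕ) : Set where
  field
    floorplan : Floorplan n
    alternating : IsAlternating floorplan
open AlternatingFloorplan public

bottomRight topLeft : Tile → Point
bottomRight t = x₂ t , y₁ t
topLeft t = x₁ t , y₂ t

{-# OPTIONS --safe #-}
-- Number the unit cells just north-west of the path: cell v has south-west
-- corner pathPt v, and steps v and v + 1 of the path run along two adjacent
-- sides of it (bottom and right for even v, left and top for odd v). Since
-- those steps lie on tile boundaries, the tile containing cell v has exactly
-- these sides there, so its bottom-right (v even) or top-left (v odd) corner
-- is pathPt (v + 1). This assigns a tile to each of the n cells, injectively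
-- because a tile cannot have both corners on the monotone path; with n tiles
-- the assignment is onto, so every tile has such a corner.
module Submission where

open import Defs
open import Data.Nat using (ℕ; zero; suc; _+_; _≤_; _<_; s≤s; ⌊_/2⌋; ⌈_/2⌉)
open import Data.Nat.Properties
open import Data.Fin using (Fin; toℕ; punchOut)
open import Data.Fin.Properties using (toℕ<n; toℕ-injective; any?; punchOut-injective; injective⇒≤)
  renaming (_≟_ to _≟ᶠ_)
open import Data.Product using (_×_; _,_; proj₁; proj₂; ∃; swap)
open import Data.Sum using (_⊎_; inj₁; inj₂)
import Data.Sum as Sum
open import Data.Empty using (⊥)
open import Function using (_∘_)
open import Function.Definitions using (Injective)
open import Relation.Nullary using (yes; no; contradiction)
open import Relation.Binary.PropositionalEquality

injective⇒surjective : ∀ {n} {f : Fin n → Fin n} → Injective _≡_ _≡_ f → ∀ i → ∃ λ v → f v ≡ i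
injective⇒surjective {zero} _ ()
injective⇒surjective {suc m} {f} f-inj i with any? (λ v → f v ≟ᶠ i)
... | yes hit = hit
... | no miss = contradiction (injective⇒≤ g-inj) 1+n≰n
  where
  i≢f : ∀ v → i ≢ f v
  i≢f v i≡fv = miss (v , sym i≡fv)

  g : Fin (suc m) → Fin m
  g v = punchOut (i≢f v)

  g-inj : Injective _≡_ _≡_ g
  g-inj {v} {w} = f-inj ∘ punchOut-injective (i≢f v) (i≢f w)

⌈n/2⌉≡⌊n/2⌋⊎1+⌊n/2⌋ : ∀ n → ⌈ n /2⌉ ≡ ⌊ n /2⌋ ⊎ ⌈ n /2⌉ ≡ suc ⌊ n /2⌋
⌈n/2⌉≡⌊n/2⌋⊎1+⌊n/2⌋ zero = inj₁ refl
⌈n/2⌉≡⌊n/2⌋⊎1+⌊n/2⌋ (suc zero) = inj₂ refl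
⌈n/2⌉≡⌊n/2⌋⊎1+⌊n/2⌋ (suc (suc n)) = Sum.map (cong suc) (cong suc) (⌈n/2⌉≡⌊n/2⌋⊎1+⌊n/2⌋ n)

⌊n/2⌋-reflects-< : ∀ {m n} → ⌊ m /2⌋ < ⌊ n /2⌋ → m < n
⌊n/2⌋-reflects-< lt = ≰⇒> (<⇒≱ lt ∘ ⌊n/2⌋-mono)

⌈n/2⌉-reflects-< : ∀ {m n} → ⌈ m /2⌉ < ⌈ n /2⌉ → m < n
⌈n/2⌉-reflects-< lt = ≰⇒> (<⇒≱ lt ∘ ⌈n/2⌉-mono)

pathPt-injective : ∀ {p q} → pathPt p ≡ pathPt q → p ≡ q
pathPt-injective {p} {q} eq = begin
  p                   ≡⟨ sym (⌊n/2⌋+⌈n/2⌉≡n p) ⟩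
  ⌊ p /2⌋ + ⌈ p /2⌉   ≡⟨ cong₂ _+_ (cong proj₂ eq) (cong proj₁ eq) ⟩
  ⌊ q /2⌋ + ⌈ q /2⌉   ≡⟨ ⌊n/2⌋+⌈n/2⌉≡n q ⟩
  q                   ∎
  where open ≡-Reasoning

transpose : Tile → Tile
transpose t = record
  { x₁ = y₁ t ; x₂ = y₂ t ; y₁ = x₁ t ; y₂ = x₂ t
  ; x₁<x₂ = y₁<y₂ t ; y₁<y₂ = x₁<x₂ t }

HorizontalEdge : Tile → ℕ → ℕ → Set
HorizontalEdge t a b = (b ≡ y₁ t ⊎ b ≡ y₂ t) × x₁ t ≤ a × a < x₂ t

eastStep⇒edge : ∀ t {a b} → SegOnBoundary t (a , b) (suc a , b) → HorizontalEdge t a b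
eastStep⇒edge _ (inj₁ (refl , refl , side , left , right)) = side , left , right
eastStep⇒edge _ (inj₂ (() , _))

-- Vertical edges of t are the horizontal edges of its transpose.
northStep⇒edge : ∀ t {a b} → SegOnBoundary t (a , b) (a , suc b) → HorizontalEdge (transpose t) b a
northStep⇒edge _ (inj₁ (() , _))
northStep⇒edge _ (inj₂ (refl , refl , side , below , above)) = side , below , above

record CellDisjoint {I : Set} (T : I → Tile) : Set where
  constructor cellDisjoint
  field
    sameCell⇒≡ : ∀ i j a b → ContainsCell (T i) a b → ContainsCell (T j) a b → i ≡ j
open CellDisjoint

transpose-disjoint : ∀ {I} {T : I → Tile} → CellDisjoint T → CellDisjoint (transpose ∘ T)
transpose-disjoint disj = cellDisjoint λ i j a b c c′ → sameCell⇒≡ disj i j b a (swap c) (swap c′)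

cell-above-bottom : ∀ t {a b} → b ≡ y₁ t → x₁ t ≤ a × a < x₂ t → ContainsCell t a b
cell-above-bottom t b≡y₁ cols = cols , ≤-reflexive (sym b≡y₁) , subst (_< y₂ t) (sym b≡y₁) (y₁<y₂ t)

cell-below-top : ∀ t {a b} → suc b ≡ y₂ t → x₁ t ≤ a × a < x₂ t → ContainsCell t a b
cell-below-top t b+1≡y₂ cols = cols , ≤-pred (subst (y₁ t <_) (sym b+1≡y₂) (y₁<y₂ t)) , ≤-reflexive b+1≡y₂

module _ {I : Set} {T : I → Tile} (disj : CellDisjoint T) where

  bottomEdge⇒y₁≡ : ∀ t j {a b} → ContainsCell (T t) a b → HorizontalEdge (T j) a b → y₁ (T t) ≡ b
  bottomEdge⇒y₁≡ t j c (inj₁ b≡y₁ , cols)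
    with sameCell⇒≡ disj t j _ _ c (cell-above-bottom (T j) b≡y₁ cols)
  ... | refl = sym b≡y₁
  bottomEdge⇒y₁≡ t j (_ , y₁≤b , _) (inj₂ _ , _) with m≤n⇒m<n∨m≡n y₁≤b
  ... | inj₂ y₁≡b = y₁≡b
  bottomEdge⇒y₁≡ t j (cols , _ , b<y₂) (inj₂ b≡y₂ , cols′) | inj₁ (s≤s y₁≤b-1)
    with sameCell⇒≡ disj t j _ _ (cols , y₁≤b-1 , <-trans (n<1+n _) b<y₂) (cell-below-top (T j) b≡y₂ cols′)
  ... | refl = contradiction b≡y₂ (<⇒≢ b<y₂)

  topEdge⇒y₂≡ : ∀ t j {a b} → ContainsCell (T t) a b → HorizontalEdge (T j) a (suc b) → y₂ (T t) ≡ suc b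
  topEdge⇒y₂≡ t j c (inj₂ b+1≡y₂ , cols)
    with sameCell⇒≡ disj t j _ _ c (cell-below-top (T j) b+1≡y₂ cols)
  ... | refl = sym b+1≡y₂
  topEdge⇒y₂≡ t j (_ , _ , b<y₂) (inj₁ _ , _) with m≤n⇒m<n∨m≡n b<y₂
  ... | inj₂ b+1≡y₂ = sym b+1≡y₂
  topEdge⇒y₂≡ t j (cols , y₁≤b , _) (inj₁ b+1≡y₁ , cols′) | inj₁ b+1<y₂
    with sameCell⇒≡ disj t j _ _ (cols , m≤n⇒m≤1+n y₁≤b , b+1<y₂) (cell-above-bottom (T j) b+1≡y₁ cols′)
  ... | refl = contradiction (≤-reflexive b+1≡y₁) (<⇒≱ (s≤s y₁≤b))

leftEdge⇒x₁≡ : ∀ {I} {T : I → Tile} → CellDisjoint T → ∀ t j {a b} →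
  ContainsCell (T t) a b → HorizontalEdge (transpose (T j)) b a → x₁ (T t) ≡ a
leftEdge⇒x₁≡ disj t j c = bottomEdge⇒y₁≡ (transpose-disjoint disj) t j (swap c)

rightEdge⇒x₂≡ : ∀ {I} {T : I → Tile} → CellDisjoint T → ∀ t j {a b} →
  ContainsCell (T t) a b → HorizontalEdge (transpose (T j)) b (suc a) → x₂ (T t) ≡ suc a
rightEdge⇒x₂≡ disj t j c = topEdge⇒y₂≡ (transpose-disjoint disj) t j (swap c)

-- The path is monotone, so no path point lies strictly north-west of another.
bottomRight∧topLeft-onPath⇒⊥ : ∀ t {p q} → bottomRight t ≡ pathPt p → topLeft t ≡ pathPt q → ⊥
bottomRight∧topLeft-onPath⇒⊥ t {p} {q} br tl = <-asym q<p p<q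
  where
  q<p : q < p
  q<p = ⌈n/2⌉-reflects-< (subst₂ _<_ (cong proj₁ tl) (cong proj₁ br) (x₁<x₂ t))

  p<q : p < q
  p<q = ⌊n/2⌋-reflects-< (subst₂ _<_ (cong proj₂ br) (cong proj₂ tl) (y₁<y₂ t))

CornerAt : Tile → ℕ → Set
CornerAt t p = bottomRight t ≡ pathPt p ⊎ topLeft t ≡ pathPt p

cornerAt-injective : ∀ t {p q} → CornerAt t p → CornerAt t q → p ≡ q
cornerAt-injective t (inj₁ br) (inj₁ br′) = pathPt-injective (trans (sym br) br′)
cornerAt-injective t (inj₂ tl) (inj₂ tl′) = pathPt-injective (trans (sym tl) tl′)
cornerAt-injective t (inj₁ br) (inj₂ tl′) = contradiction tl′ (bottomRight∧topLeft-onPath⇒⊥ t br)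
cornerAt-injective t (inj₂ tl) (inj₁ br′) = contradiction tl (bottomRight∧topLeft-onPath⇒⊥ t br′)

-- With a = ⌈ v /2⌉ and b = ⌊ v /2⌋, the path points v, v + 1, v + 2 are
-- (a , b), (1 + b , a), (1 + a , 1 + b), and a ≡ b exactly when v is even.
pathCell-corner : ∀ {I} {T : I → Tile} → CellDisjoint T → ∀ t {a b} → a ≡ b ⊎ a ≡ suc b →
  ContainsCell (T t) a b →
  ∃ (λ j → SegOnBoundary (T j) (a , b) (suc b , a)) →
  ∃ (λ j → SegOnBoundary (T j) (suc b , a) (suc a , suc b)) →
  bottomRight (T t) ≡ (suc b , a) ⊎ topLeft (T t) ≡ (suc b , a)
pathCell-corner {T = T} disj t (inj₁ refl) c (j , east) (j′ , north) = inj₁ (cong₂ _,_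
  (rightEdge⇒x₂≡ disj t j′ c (northStep⇒edge (T j′) north))
  (bottomEdge⇒y₁≡ disj t j c (eastStep⇒edge (T j) east)))
pathCell-corner {T = T} disj t (inj₂ refl) c (j , north) (j′ , east) = inj₂ (cong₂ _,_
  (leftEdge⇒x₁≡ disj t j c (northStep⇒edge (T j) north))
  (topEdge⇒y₂≡ disj t j′ c (eastStep⇒edge (T j′) east)))

pathCell-inside : ∀ {n v} → v < n → ⌈ v /2⌉ < width n × ⌊ v /2⌋ < height n
pathCell-inside v<n = ⌈n/2⌉-mono (s≤s v<n) , ⌊n/2⌋-mono (s≤s v<n)

module _ {n : ℕ} (A : AlternatingFloorplan n) where
  private
    F = floorplan A

  tiles-disjoint : CellDisjoint (tile F)
  tiles-disjoint = cellDisjoint (disjoint F)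

  pathCell-cover : (v : Fin n) → ∃ λ i → ContainsCell (tile F i) ⌈ toℕ v /2⌉ ⌊ toℕ v /2⌋
  pathCell-cover v = cover F _ _ w h
    where
    w = proj₁ (pathCell-inside (toℕ<n v))
    h = proj₂ (pathCell-inside (toℕ<n v))

  pathTile : Fin n → Fin n
  pathTile v = proj₁ (pathCell-cover v)

  pathTile-corner : ∀ v → CornerAt (tile F (pathTile v)) (suc (toℕ v))
  pathTile-corner v = pathCell-corner tiles-disjoint (pathTile v) (⌈n/2⌉≡⌊n/2⌋⊎1+⌊n/2⌋ (toℕ v))
    (proj₂ (pathCell-cover v))
    (alternating A (toℕ v) (<⇒≤ (toℕ<n v)))
    (alternating A (suc (toℕ v)) (toℕ<n v))

  pathTile-injective : Injective _≡_ _≡_ pathTile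
  pathTile-injective {v} {w} same =
    toℕ-injective (suc-injective (cornerAt-injective (tile F (pathTile w)) corner-v (pathTile-corner w)))
    where
    corner-v : CornerAt (tile F (pathTile w)) (suc (toℕ v))
    corner-v = subst (λ i → CornerAt (tile F i) _) same (pathTile-corner v)

lemma6p6 : (n : ℕ) (F : AlternatingFloorplan n) (i : Fin n) →
    OnPath n (bottomRight (tile (floorplan F) i)) ⊎ OnPath n (topLeft (tile (floorplan F) i))
lemma6p6 n A i with injective⇒surjective (pathTile-injective A) i
... | v , refl = Sum.map onPath onPath (pathTile-corner A v)
  where
  onPath : ∀ {p} → p ≡ pathPt (suc (toℕ v)) → OnPath n p
  onPath e = suc (toℕ v) , s≤s (<⇒≤ (toℕ<n v)) , sym e
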